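{- Let $(U,\mathcal{D},G^*)$ be a standard configuration with a chosen primitive nesting for each orbit. Let $c,s\in U$ be elements whose orbits $D_c,D_s$ each have at least two elements, let $C=\{c\}$, $S=\{s\}$, and let $C^\dagger$, $S^\dagger$ be their successors. Suppose that $C^\dagger\blacktriangleright^{S^\dagger}S$ fails and $S^\dagger\blacktriangleright^{C^\dagger}C$ fails. Then any two elements of $C^\dagger$ are comparable to the same number of elements of $S^\dagger$, and any two elements of $S^\dagger$ are comparable to the same number of elements of $C^\dagger$. Moreover, if $C\blacktriangleright^{S^\dagger}S$, then also $S\blacktriangleright^{C^\dagger}C$, every element of $C^\dagger$ is comparable to fewer than $|S^\dagger|$ elements of $S^\dagger$, and every element of $S^\dagger$ is comparable to fewer than $|C^\dagger|$ elements of $C^\dagger$. Finally, if $C\blacktriangleright^{S^\dagger}S$ and $|S^\dagger|$ is prime, then $|S^\dagger|$ divides $|C^\dagger|$.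
   Context: A standard configuration $(U,\mathcal{D},G^*)$: $U$ is a finite ordered set containing no nontrivial order-autonomous antichain (a nonempty $A\subseteq U$ is order-autonomous iff for every $z\notin A$, $z<a$ for some $a\in A$ implies $z<A$, and $z>a$ for some $a\in A$ implies $z>A$; nontrivial means $|A|\notin\{1,|U|\}$), $G^*$ is a subgroup of ${\rm Aut}(U)$, $\mathcal{D}$ is the set of $G^*$-orbits. For $D\in\mathcal{D}$, $\Lambda^*(D)=\{\Phi|_D:\Phi\in G^*\}$; a block of $\Lambda^*(D)$ is $B\subseteq D$ with $\sigma[B]=B$ or $\sigma[B]\cap B=\emptyset$ for all $\sigma\in\Lambda^*(D)$; $\Lambda^*(D)\cdot B=\{\Phi[B]:\Phi\in G^*\}$. For blocks $S\subsetneq B$, $B[\Lambda^*(D)\cdot S]=\{S'\in\Lambda^*(D)\cdot S:S'\subseteq B\}$; $(S,B)$ is a primitive pair iff $\{X\mapsto\Phi[X]\text{ on }B[\Lambda^*(D)\cdot S]:\Phi\in G^*,\Phi[B]\subseteq B\}$ is a primitive permutation group on $B[\Lambda^*(D)\cdot S]$. A primitive nesting for $\Lambda^*(D)$ is a chain of blocks $\{x^D\}=B^D_0\subsetneq B^D_1\subsetneq\cdots\subsetneq B^D_{m_D}=D$ with each $(B^D_{j-1},B^D_j)$ a primitive pair. For $c\in D$ with $|D|\geq 2$, the successor of $\{c\}$ is $\{c\}^\dagger=\Phi[B^D_1]$ for any $\Phi\in G^*$ with $\Phi(x^D)=c$ (the unique conjugate of $B^D_1$ containing $c$); $(\{c\},\{c\}^\dagger)$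 is a primitive pair. Weaving type of a pair $(X,Y)$ of blocks: "made" if $X<Y$ or $X>Y$ elementwise strictly; "incomparable" if no element of $X$ is comparable to an element of $Y$; otherwise nontrivially woven, with type the class $\{(\Phi[X],\Phi[Y]):\Phi\in G^*\}$. For a primitive pair $(S,B)$ of $\Lambda^*(D)$ and a block $X$ of some $\Lambda^*(E)$, $X\blacktriangleright^B S$ iff the pairs $(X,S')$, $S'\in B[\Lambda^*(D)\cdot S]$, do not all have the same weaving type. (For singletons, $\{c\}\blacktriangleright^{S^\dagger}\{s\}$ means $c$ is comparable to at least one but not all elements of $S^\dagger$.) -}

module Defs where

open import Data.Nat using (ℕ; zero; suc; _<_; _≤_)
open import Data.Fin using (Fin; _≟_)
open import Data.Fin.Subset using (Subset; _∈_; _∉_; _⊆_; _⊂_; _∩_; ⁅_⁆; ∣_∣; Empty; Nonempty)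
open import Data.Fin.Subset.Properties using (_∈?_)
open import Data.Fin.Properties using (any?)
open import Data.Vec using (tabulate)
open import Data.Product using (Σ; ∃; _×_; _,_)
open import Data.Sum using (_⊎_)
open import Data.Empty using (⊥)
open import Data.Bool using (Bool; true)
open import Function using (id; _∘_)
open import Function.Bundles using (_⇔_)
open import Function.Definitions using (Injective; Surjective)
open import Relation.Nullary using (¬_; Dec)
open import Relation.Nullary.Decidable using (⌊_⌋; _×-dec_; _⊎-dec_)
open import Relation.Binary using (Decidable)
open import Relation.Binary.PropositionalEquality using (_≡_; _≢_)

Comparable : ∀ {n} → (Fin n → Fin n → Set) → Fin n → Fin n → Set
Comparable _≺_ x y = x ≡ y ⊎ x ≺ y ⊎ y ≺ x

IsAntichain : ∀ {n} → (Fin n → Fin n → Set) → Subset n → Set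
IsAntichain _≺_ A = ∀ {a b} → a ∈ A → b ∈ A → ¬ (a ≺ b)

IsOrderAutonomous : ∀ {n} → (Fin n → Fin n → Set) → Subset n → Set
IsOrderAutonomous _≺_ A =
  Nonempty A ×
  (∀ z → z ∉ A →
     ((∃ λ a → a ∈ A × z ≺ a) → ∀ a → a ∈ A → z ≺ a) ×
     ((∃ λ a → a ∈ A × a ≺ z) → ∀ a → a ∈ A → a ≺ z))

IsAut : ∀ {n} → (Fin n → Fin n → Set) → (Fin n → Fin n) → Set
IsAut _≺_ Φ = Injective _≡_ _≡_ Φ × Surjective _≡_ _≡_ Φ ×
              (∀ x y → (x ≺ y) ⇔ (Φ x ≺ Φ y))

-- Standard configuration: finite ordered set without nontrivial
-- order-autonomous antichain, plus a subgroup G of Aut(U)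
-- (given as a predicate on maps, closed under id, ∘ and inverses).

record StdConfig (n : ℕ) : Set₁ where
  field
    _≺_      : Fin n → Fin n → Set
    _≺?_     : Decidable _≺_
    ≺-irrefl : ∀ x → ¬ (x ≺ x)
    ≺-trans  : ∀ {x y z} → x ≺ y → y ≺ z → x ≺ z
    noNontrivAutAntichain : ∀ (A : Subset n) → IsAntichain _≺_ A →
      IsOrderAutonomous _≺_ A → ∣ A ∣ ≡ 1 ⊎ ∣ A ∣ ≡ n
    G     : (Fin n → Fin n) → Set
    G-aut : ∀ {Φ} → G Φ → IsAut _≺_ Φ
    G-id  : G id
    G-∘   : ∀ {Φ Ψ} → G Φ → G Ψ → G (Φ ∘ Ψ)
    G-inv : ∀ {Φ} → G Φ → ∃ λ Ψ → G Ψ × (∀ x → Ψ (Φ x) ≡ x)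

image : ∀ {n} → (Fin n → Fin n) → Subset n → Subset n
image Φ B = tabulate (λ y → ⌊ any? (λ x → (x ∈? B) ×-dec (Φ x ≟ y)) ⌋)

-- data of a chain of blocks  {base} = chain 0 ⊂ … ⊂ chain len
-- (only indices ≤ len are meaningful)
record Nesting (n : ℕ) : Set where
  field
    base  : Fin n
    len   : ℕ
    chain : ℕ → Subset n

module _ {n : ℕ} (K : StdConfig n) where
  open StdConfig K

  InOrbit : Fin n → Fin n → Set
  InOrbit x y = ∃ λ Φ → G Φ × Φ x ≡ y

  -- B is a block of Λ*(D), D the orbit of x
  IsBlock : Fin n → Subset n → Set
  IsBlock x B = (∀ y → y ∈ B → InOrbit x y) ×
                (∀ Φ → G Φ → image Φ B ≡ B ⊎ Empty (image Φ B ∩ B))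

  Conj : Subset n → Subset n → Subset n → Set
  Conj S B X = (∃ λ Φ → G Φ × X ≡ image Φ S) × X ⊆ B

  -- elements of the induced group on B[Λ*(D)·S]: Φ ∈ G with Φ[B] ⊆ B
  Stab : Subset n → (Fin n → Fin n) → Set
  Stab B Φ = G Φ × image Φ B ⊆ B

  -- a set 𝒜 of members of B[Λ*(D)·S] (a set of subsets of the finite
  -- set Fin n, given by its Bool-valued indicator 𝒜₀) is a nontrivial
  -- block of the induced permutation group
  IsNontrivBlockAct : Subset n → Subset n → (Subset n → Bool) → Set
  IsNontrivBlockAct S B 𝒜₀ =
    (∀ X → 𝒜 X → Conj S B X) ×
    (∃ λ X → ∃ λ Y → 𝒜 X × 𝒜 Y × X ≢ Y) ×
    (∃ λ X → Conj S B X × ¬ 𝒜 X) ×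
    (∀ Φ → Stab B Φ →
      (∀ Y → (∃ λ X → 𝒜 X × image Φ X ≡ Y) ⇔ 𝒜 Y) ⊎
      (∀ Y → (∃ λ X → 𝒜 X × image Φ X ≡ Y) → ¬ 𝒜 Y))
    where 𝒜 : Subset n → Set
          𝒜 X = 𝒜₀ X ≡ true

  PrimitivePair : Subset n → Subset n → Set
  PrimitivePair S B =
    (∀ X Y → Conj S B X → Conj S B Y →
       ∃ λ Φ → Stab B Φ × image Φ X ≡ Y) ×
    ¬ (∃ λ 𝒜 → IsNontrivBlockAct S B 𝒜)

  IsPrimitiveNesting : Fin n → Nesting n → Set
  IsPrimitiveNesting x N =
    InOrbit x base ×
    chain 0 ≡ ⁅ base ⁆ ×
    (∀ y → (y ∈ chain len) ⇔ InOrbit x y) ×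
    (∀ i → i ≤ len → IsBlock x (chain i)) ×
    (∀ i → i < len → chain i ⊂ chain (suc i)) ×
    (∀ i → i < len → PrimitivePair (chain i) (chain (suc i)))
    where open Nesting N

  Made : Subset n → Subset n → Set
  Made X Y = (∀ x y → x ∈ X → y ∈ Y → x ≺ y) ⊎
             (∀ x y → x ∈ X → y ∈ Y → y ≺ x)

  Incomparable : Subset n → Subset n → Set
  Incomparable X Y = ∀ x y → x ∈ X → y ∈ Y → ¬ Comparable _≺_ x y

  Woven : Subset n → Subset n → Set
  Woven X Y = ¬ Made X Y × ¬ Incomparable X Y

  SameWeavingType : Subset n → Subset n → Subset n → Subset n → Set
  SameWeavingType X Y X′ Y′ =
    (Made X Y × Made X′ Y′) ⊎
    (Incomparable X Y × Incomparable X′ Y′) ⊎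
    (Woven X Y × Woven X′ Y′ ×
      ∃ λ Φ → G Φ × image Φ X ≡ X′ × image Φ Y ≡ Y′)

  Triangle : Subset n → Subset n → Subset n → Set
  Triangle X B S = ¬ (∀ S₁ S₂ → Conj S B S₁ → Conj S B S₂ →
                        SameWeavingType X S₁ X S₂)

  comparableTo : Fin n → Subset n
  comparableTo a = tabulate (λ y → ⌊ (a ≟ y) ⊎-dec ((a ≺? y) ⊎-dec (y ≺? a)) ⌋)

  #comparable : Fin n → Subset n → ℕ
  #comparable a T = ∣ T ∩ comparableTo a ∣

-- Let k be the number of elements of S† comparable to c and l the number of
-- elements of C† comparable to s.  Failure of C† ▶ S and of S† ▶ C says that
-- all singletons of S† (resp. C†) have the same weaving type with C† (resp.
-- S†), so these numbers are constant, k and l, and double counting comparable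
-- pairs gives ∣C†∣ k = ∣S†∣ l.  If c ▶ S, then c is comparable to some element
-- of S† (0 < k) and not to all of them (k < ∣S†∣): for c ∉ S† all pairs
-- ({c}, {b}) would be made, and for c ∈ S† we would get C† ⊆ S† and an
-- automorphism stabilising C† moving c to a comparable element of C†, which
-- the strict monotonicity of "number of elements of C† below" forbids.  Hence
-- 0 < l < ∣C†∣, so s ▶ C, and if ∣S†∣ is prime it divides ∣C†∣ k with
-- 0 < k < ∣S†∣, hence divides ∣C†∣.
module Submission where

open import Defs
open import Data.Bool using (true; false; _∧_; if_then_else_)
open import Data.Bool.Properties using (T-≡)
open import Data.Nat using (ℕ; zero; suc; _*_; _<_; _≤_; NonZero; >-nonZero; z<s)
open import Data.Nat.Properties
  using (+-*-semiring; *-commutativeSemigroup; *-comm; *-zeroʳ; *-monoʳ-<; *-cancelˡ-<;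
         <-irrefl; <⇒≱; ≰⇒>; n≢0⇒n>0; m<n⇒0<n; module ≤-Reasoning)
  renaming (_≟_ to _≟ℕ_)
open import Data.Nat.Divisibility using (_∣_; divides; ∣⇒≤)
open import Data.Nat.Primality using (Prime; euclidsLemma)
open import Data.Fin using (Fin; _≟_)
open import Data.Fin.Subset using (Subset; _∈_; _∉_; _⊆_; _∩_; ⁅_⁆; ∣_∣)
open import Data.Fin.Subset.Properties
  using (_∈?_; x∈p∩q⁺; x∈p∩q⁻; x∈⁅x⁆; x∈⁅y⁆⇒x≡y; ∉⊥; ∣⊥∣≡0; ⊆-antisym;
         x∈p⇒∣p-x∣<∣p∣; p⊂q⇒∣p∣<∣q∣; p⊆q⇒∣p∣≤∣q∣; ∣⁅x⁆∣≡1)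
open import Data.Fin.Properties using (any?)
open import Data.Vec using ([]; _∷_; lookup; tabulate)
open import Data.Vec.Properties using (lookup∘tabulate; []=⇒lookup; lookup⇒[]=; lookup-zipWith)
open import Data.Product using (∃; _×_; _,_; proj₁; proj₂)
open import Data.Sum using (_⊎_; inj₁; inj₂)
open import Data.Empty using (⊥; ⊥-elim)
open import Function using (id; _∘_; const)
open import Function.Bundles using (_⇔_; mk⇔; mk⤖; Equivalence)
open import Function.Definitions using (Injective; Surjective)
open import Function.Properties.Bijection using (⤖⇒↔)
open import Relation.Nullary using (¬_; Dec; yes; no; contradiction)
open import Relation.Nullary.Decidable
  using (⌊_⌋; toWitness; fromWitness; decidable-stable; _×-dec_; _⊎-dec_)
open import Relation.Unary using (Pred; Decidable)
open import Relation.Binary.PropositionalEquality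
  using (_≡_; _≢_; refl; sym; trans; cong; subst; subst₂; module ≡-Reasoning)
open import Algebra.Properties.Semiring.Sum +-*-semiring
  using (sum; sum-cong-≗; ∑-comm; ∑-permute; *-distribˡ-sum; *-distribʳ-sum)
open import Algebra.Properties.CommutativeSemigroup *-commutativeSemigroup using (x∙yz≈y∙xz)

open Equivalence using (to; from)

module _ {n ℓ} {P : Pred (Fin n) ℓ} (P? : Decidable P) where

  ∈-tabulate⁺ : ∀ {i} → P i → i ∈ tabulate (λ j → ⌊ P? j ⌋)
  ∈-tabulate⁺ {i} p =
    lookup⇒[]= i _ (trans (lookup∘tabulate _ i) (to T-≡ (fromWitness {a? = P? i} p)))

  ∈-tabulate⁻ : ∀ {i} → i ∈ tabulate (λ j → ⌊ P? j ⌋) → P i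
  ∈-tabulate⁻ {i} i∈ =
    toWitness {a? = P? i} (from T-≡ (trans (sym (lookup∘tabulate _ i)) ([]=⇒lookup i∈)))

module _ {n} {Φ : Fin n → Fin n} {B : Subset n} where

  ∈-image⁺ : ∀ {x} → x ∈ B → Φ x ∈ image Φ B
  ∈-image⁺ {x} x∈B = ∈-tabulate⁺ (λ y → any? (λ z → (z ∈? B) ×-dec (Φ z ≟ y))) (x , x∈B , refl)

  ∈-image⁻ : ∀ {y} → y ∈ image Φ B → ∃ λ x → x ∈ B × Φ x ≡ y
  ∈-image⁻ = ∈-tabulate⁻ (λ y → any? (λ z → (z ∈? B) ×-dec (Φ z ≟ y)))

image-⁅⁆ : ∀ {n} {Φ : Fin n → Fin n} {a} → image Φ ⁅ a ⁆ ≡ ⁅ Φ a ⁆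
image-⁅⁆ {Φ = Φ} {a} = ⊆-antisym
  (λ y∈ → let (x , x∈⁅a⁆ , Φx≡y) = ∈-image⁻ y∈ in
    subst (_∈ ⁅ Φ a ⁆) (trans (cong Φ (sym (x∈⁅y⁆⇒x≡y a x∈⁅a⁆))) Φx≡y) (x∈⁅x⁆ (Φ a)))
  (λ {y} y∈ → subst (_∈ image Φ ⁅ a ⁆) (sym (x∈⁅y⁆⇒x≡y (Φ a) y∈)) (∈-image⁺ (x∈⁅x⁆ a)))

⁅⁆-injective : ∀ {n} {a b : Fin n} → ⁅ a ⁆ ≡ ⁅ b ⁆ → a ≡ b
⁅⁆-injective {a = a} {b} e = x∈⁅y⁆⇒x≡y b (subst (a ∈_) e (x∈⁅x⁆ a))

-- Cardinalities as sums of indicators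

indicator : ∀ {n} → Subset n → Fin n → ℕ
indicator p i = if lookup p i then 1 else 0

module _ {n} {p : Subset n} {i : Fin n} where

  indicator-∈ : i ∈ p → indicator p i ≡ 1
  indicator-∈ i∈p = cong (if_then 1 else 0) ([]=⇒lookup i∈p)

  indicator-∉ : i ∉ p → indicator p i ≡ 0
  indicator-∉ i∉p with lookup p i in e
  ... | true  = contradiction (lookup⇒[]= i p e) i∉p
  ... | false = refl

indicator-cong : ∀ {n} {p q : Subset n} {i j} → (i ∈ p → j ∈ q) → (j ∈ q → i ∈ p) →
                 indicator p i ≡ indicator q j
indicator-cong {p = p} {i = i} i∈p⇒ j∈q⇒ with i ∈? p
... | yes i∈p = trans (indicator-∈ i∈p) (sym (indicator-∈ (i∈p⇒ i∈p)))
... | no  i∉p = trans (indicator-∉ i∉p) (sym (indicator-∉ (i∉p ∘ j∈q⇒)))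

indicator-∩ : ∀ {n} (p q : Subset n) i → indicator (p ∩ q) i ≡ indicator p i * indicator q i
indicator-∩ p q i rewrite lookup-zipWith _∧_ i p q with lookup p i | lookup q i
... | true  | true  = refl
... | true  | false = refl
... | false | _     = refl

∣p∣≡∑indicator : ∀ {n} (p : Subset n) → ∣ p ∣ ≡ sum (indicator p)
∣p∣≡∑indicator []          = refl
∣p∣≡∑indicator (true ∷ p)  = cong suc (∣p∣≡∑indicator p)
∣p∣≡∑indicator (false ∷ p) = ∣p∣≡∑indicator p

∣p∩q∣≡∑indicator* : ∀ {n} (p q : Subset n) → ∣ p ∩ q ∣ ≡ sum (λ i → indicator p i * indicator q i)
∣p∩q∣≡∑indicator* p q = trans (∣p∣≡∑indicator (p ∩ q)) (sum-cong-≗ (indicator-∩ p q))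

∑indicator*-const : ∀ {n} (p : Subset n) {f : Fin n → ℕ} {k} → (∀ i → i ∈ p → f i ≡ k) →
                    sum (λ i → indicator p i * f i) ≡ ∣ p ∣ * k
∑indicator*-const p {f} {k} f≡k = begin
  sum (λ i → indicator p i * f i) ≡⟨ sum-cong-≗ on-p ⟩
  sum (λ i → indicator p i * k)   ≡⟨ *-distribʳ-sum k (indicator p) ⟨
  sum (indicator p) * k           ≡⟨ cong (_* k) (∣p∣≡∑indicator p) ⟨
  ∣ p ∣ * k                       ∎
  where
  open ≡-Reasoning
  on-p : ∀ i → indicator p i * f i ≡ indicator p i * k
  on-p i with i ∈? p
  ... | yes i∈p = cong (indicator p i *_) (f≡k i i∈p)
  ... | no  i∉p = trans (cong (_* f i) (indicator-∉ i∉p)) (cong (_* k) (sym (indicator-∉ i∉p)))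

bijection⇒∣p∣≡∣q∣ : ∀ {n} {π : Fin n → Fin n} → Injective _≡_ _≡_ π → Surjective _≡_ _≡_ π →
                    {p q : Subset n} → (∀ i → i ∈ p → π i ∈ q) → (∀ i → π i ∈ q → i ∈ p) →
                    ∣ p ∣ ≡ ∣ q ∣
bijection⇒∣p∣≡∣q∣ {π = π} π-inj π-surj {p} {q} ⇒∈q ⇒∈p = begin
  ∣ p ∣                ≡⟨ ∣p∣≡∑indicator p ⟩
  sum (indicator p)     ≡⟨ sum-cong-≗ (λ i → indicator-cong (⇒∈q i) (⇒∈p i)) ⟩
  sum (indicator q ∘ π) ≡⟨ ∑-permute (indicator q) (⤖⇒↔ (mk⤖ (π-inj , π-surj))) ⟨
  sum (indicator q)     ≡⟨ ∣p∣≡∑indicator q ⟨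
  ∣ q ∣                 ∎
  where open ≡-Reasoning

-- Double counting the pairs (a , b) ∈ X × Y with b ∈ R a, for a symmetric R

module _ {n} (R : Fin n → Subset n) (R-sym : ∀ {a b} → b ∈ R a → a ∈ R b) where

  private
    ∑indicator*∣∩∣ : ∀ (X Y : Subset n) a → indicator X a * ∣ Y ∩ R a ∣ ≡
                     sum (λ b → indicator X a * (indicator Y b * indicator (R a) b))
    ∑indicator*∣∩∣ X Y a =
      trans (cong (indicator X a *_) (∣p∩q∣≡∑indicator* Y (R a)))
            (*-distribˡ-sum (indicator X a) (λ b → indicator Y b * indicator (R a) b))

  ∑indicator*∣∩∣-symmetric : ∀ X Y → sum (λ a → indicator X a * ∣ Y ∩ R a ∣) ≡
                                     sum (λ b → indicator Y b * ∣ X ∩ R b ∣)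
  ∑indicator*∣∩∣-symmetric X Y = begin
    sum (λ a → indicator X a * ∣ Y ∩ R a ∣)
      ≡⟨ sum-cong-≗ (∑indicator*∣∩∣ X Y) ⟩
    sum (λ a → sum (λ b → indicator X a * (indicator Y b * indicator (R a) b)))
      ≡⟨ ∑-comm (λ a b → indicator X a * (indicator Y b * indicator (R a) b)) ⟩
    sum (λ b → sum (λ a → indicator X a * (indicator Y b * indicator (R a) b)))
      ≡⟨ sum-cong-≗ (λ b → sum-cong-≗ (λ a → swap a b)) ⟩
    sum (λ b → sum (λ a → indicator Y b * (indicator X a * indicator (R b) a)))
      ≡⟨ sum-cong-≗ (∑indicator*∣∩∣ Y X) ⟨
    sum (λ b → indicator Y b * ∣ X ∩ R b ∣) ∎
    where
    open ≡-Reasoning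
    swap : ∀ a b → indicator X a * (indicator Y b * indicator (R a) b) ≡
                   indicator Y b * (indicator X a * indicator (R b) a)
    swap a b = trans (x∙yz≈y∙xz (indicator X a) (indicator Y b) _)
                     (cong (λ r → indicator Y b * (indicator X a * r)) (indicator-cong R-sym R-sym))

  double-counting : ∀ {X Y k l} →
    (∀ a → a ∈ X → ∣ Y ∩ R a ∣ ≡ k) → (∀ b → b ∈ Y → ∣ X ∩ R b ∣ ≡ l) → ∣ X ∣ * k ≡ ∣ Y ∣ * l
  double-counting {X} {Y} X-regular Y-regular =
    trans (sym (∑indicator*-const X X-regular))
          (trans (∑indicator*∣∩∣-symmetric X Y) (∑indicator*-const Y Y-regular))

m*k≡s*l⇒l<m : ∀ m {k s l} .{{_ : NonZero m}} → k < s → m * k ≡ s * l → l < m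
m*k≡s*l⇒l<m m {k} {s} {l} k<s mk≡sl = *-cancelˡ-< s l m (begin-strict
  s * l ≡⟨ mk≡sl ⟨
  m * k <⟨ *-monoʳ-< m k<s ⟩
  m * s ≡⟨ *-comm m s ⟩
  s * m ∎)
  where open ≤-Reasoning

m*k≡s*l⇒0<l : ∀ {m k s l} → 0 < m → 0 < k → m * k ≡ s * l → 0 < l
m*k≡s*l⇒0<l {suc m} {suc k} {s} {zero} _ _ mk≡sl with () ← trans mk≡sl (*-zeroʳ s)
m*k≡s*l⇒0<l {l = suc l} _ _ _ = z<s

prime∣m*k⇒∣m : ∀ {p m k} → Prime p → 0 < k → k < p → p ∣ m * k → p ∣ m
prime∣m*k⇒∣m {m = m} {k} p-prime 0<k k<p p∣mk with euclidsLemma m k p-prime p∣mk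
... | inj₁ p∣m = p∣m
... | inj₂ p∣k = contradiction (∣⇒≤ {{>-nonZero 0<k}} p∣k) (<⇒≱ k<p)

module _ {n} (K : StdConfig n) where
  open StdConfig K

  infix 4 _∼_
  _∼_ : Fin n → Fin n → Set
  _∼_ = Comparable _≺_

  ∼? : ∀ a b → Dec (a ∼ b)
  ∼? a b = (a ≟ b) ⊎-dec ((a ≺? b) ⊎-dec (b ≺? a))

  ∼-sym : ∀ {a b} → a ∼ b → b ∼ a
  ∼-sym (inj₁ a≡b)        = inj₁ (sym a≡b)
  ∼-sym (inj₂ (inj₁ a≺b)) = inj₂ (inj₂ a≺b)
  ∼-sym (inj₂ (inj₂ b≺a)) = inj₂ (inj₁ b≺a)

  ∈-comparableTo⁺ : ∀ {a y} → a ∼ y → y ∈ comparableTo K a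
  ∈-comparableTo⁺ {a} = ∈-tabulate⁺ (∼? a)

  ∈-comparableTo⁻ : ∀ {a y} → y ∈ comparableTo K a → a ∼ y
  ∈-comparableTo⁻ {a} = ∈-tabulate⁻ (∼? a)

  #comparable≡∣T∣ : ∀ {a T} → (∀ y → y ∈ T → a ∼ y) → #comparable K a T ≡ ∣ T ∣
  #comparable≡∣T∣ {a} {T} all∼ = cong ∣_∣ (⊆-antisym (proj₁ ∘ x∈p∩q⁻ T _)
    (λ {y} y∈T → x∈p∩q⁺ (y∈T , ∈-comparableTo⁺ (all∼ y y∈T))))

  #comparable≡0 : ∀ {a T} → (∀ y → y ∈ T → ¬ a ∼ y) → #comparable K a T ≡ 0
  #comparable≡0 {a} {T} none∼ = trans (cong ∣_∣ (⊆-antisym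
    (λ {y} y∈ → let (y∈T , y∈∼) = x∈p∩q⁻ T _ y∈ in ⊥-elim (none∼ y y∈T (∈-comparableTo⁻ y∈∼)))
    (⊥-elim ∘ ∉⊥))) (∣⊥∣≡0 n)

  #comparable-positive : ∀ {a T y} → y ∈ T → a ∼ y → 0 < #comparable K a T
  #comparable-positive {a} {T} {y} y∈T a∼y = subst (_≤ #comparable K a T) (∣⁅x⁆∣≡1 y)
    (p⊆q⇒∣p∣≤∣q∣ {p = ⁅ y ⁆} (λ {z} z∈ →
      subst (_∈ T ∩ comparableTo K a) (sym (x∈⁅y⁆⇒x≡y y z∈)) (x∈p∩q⁺ (y∈T , ∈-comparableTo⁺ a∼y))))

  #comparable<∣T∣ : ∀ {a T y} → y ∈ T → ¬ a ∼ y → #comparable K a T < ∣ T ∣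
  #comparable<∣T∣ {a} {T} {y} y∈T a≁y = p⊂q⇒∣p∣<∣q∣
    (proj₁ ∘ x∈p∩q⁻ T _ , y , y∈T , a≁y ∘ ∈-comparableTo⁻ ∘ proj₂ ∘ x∈p∩q⁻ T _)

  ∣T∣≤#comparable⇒∼ : ∀ {a T y} → ∣ T ∣ ≤ #comparable K a T → y ∈ T → a ∼ y
  ∣T∣≤#comparable⇒∼ {a} {y = y} ∣T∣≤# y∈T =
    decidable-stable (∼? a y) (λ a≁y → <⇒≱ (#comparable<∣T∣ y∈T a≁y) ∣T∣≤#)

  #comparable≤0⇒≁ : ∀ {a T y} → #comparable K a T ≤ 0 → y ∈ T → ¬ a ∼ y
  #comparable≤0⇒≁ #≤0 y∈T a∼y = <⇒≱ (#comparable-positive y∈T a∼y) #≤0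

  #comparable-double-counting : ∀ {X Y k l} →
    (∀ a → a ∈ X → #comparable K a Y ≡ k) → (∀ b → b ∈ Y → #comparable K b X ≡ l) →
    ∣ X ∣ * k ≡ ∣ Y ∣ * l
  #comparable-double-counting =
    double-counting (comparableTo K) (∈-comparableTo⁺ ∘ ∼-sym ∘ ∈-comparableTo⁻)

  module _ {Φ : Fin n → Fin n} (Φ∈G : G Φ) where

    G-injective : Injective _≡_ _≡_ Φ
    G-injective = proj₁ (G-aut Φ∈G)

    G-surjective : Surjective _≡_ _≡_ Φ
    G-surjective = proj₁ (proj₂ (G-aut Φ∈G))

    G-≺ : ∀ {x y} → x ≺ y ⇔ Φ x ≺ Φ y
    G-≺ {x} {y} = proj₂ (proj₂ (G-aut Φ∈G)) x y

    G-∼⁺ : ∀ {x y} → x ∼ y → Φ x ∼ Φ y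
    G-∼⁺ (inj₁ x≡y)        = inj₁ (cong Φ x≡y)
    G-∼⁺ (inj₂ (inj₁ x≺y)) = inj₂ (inj₁ (to G-≺ x≺y))
    G-∼⁺ (inj₂ (inj₂ y≺x)) = inj₂ (inj₂ (to G-≺ y≺x))

    G-∼⁻ : ∀ {x y} → Φ x ∼ Φ y → x ∼ y
    G-∼⁻ (inj₁ Φx≡Φy)        = inj₁ (G-injective Φx≡Φy)
    G-∼⁻ (inj₂ (inj₁ Φx≺Φy)) = inj₂ (inj₁ (from G-≺ Φx≺Φy))
    G-∼⁻ (inj₂ (inj₂ Φy≺Φx)) = inj₂ (inj₂ (from G-≺ Φy≺Φx))

    module _ {T : Subset n} (ΦT≡T : image Φ T ≡ T) where

      stable⁺ : ∀ {x} → x ∈ T → Φ x ∈ T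
      stable⁺ x∈T = subst (_ ∈_) ΦT≡T (∈-image⁺ x∈T)

      stable⁻ : ∀ {x} → Φ x ∈ T → x ∈ T
      stable⁻ Φx∈T with ∈-image⁻ (subst (_ ∈_) (sym ΦT≡T) Φx∈T)
      ... | z , z∈T , Φz≡Φx = subst (_∈ T) (G-injective Φz≡Φx) z∈T

      #comparable-invariant : ∀ a → #comparable K a T ≡ #comparable K (Φ a) T
      #comparable-invariant a = bijection⇒∣p∣≡∣q∣ G-injective G-surjective
        (λ y y∈ → let (y∈T , a∼y) = x∈p∩q⁻ T _ y∈ in
          x∈p∩q⁺ (stable⁺ y∈T , ∈-comparableTo⁺ (G-∼⁺ (∈-comparableTo⁻ a∼y))))
        (λ y Φy∈ → let (Φy∈T , Φa∼Φy) = x∈p∩q⁻ T _ Φy∈ in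
          x∈p∩q⁺ (stable⁻ Φy∈T , ∈-comparableTo⁺ (G-∼⁻ (∈-comparableTo⁻ Φa∼Φy))))

  strictlyBelow : Fin n → Subset n
  strictlyBelow a = tabulate (λ z → ⌊ z ≺? a ⌋)

  #below : Subset n → Fin n → ℕ
  #below T a = ∣ T ∩ strictlyBelow a ∣

  #below-monotone : ∀ {T a b} → a ∈ T → a ≺ b → #below T a < #below T b
  #below-monotone {T} {a} {b} a∈T a≺b = p⊂q⇒∣p∣<∣q∣
    ( (λ z∈ → let (z∈T , z≺a) = x∈p∩q⁻ T _ z∈ in
        x∈p∩q⁺ (z∈T , ∈-tabulate⁺ (_≺? b) (≺-trans (∈-tabulate⁻ (_≺? a) z≺a) a≺b)))
    , a , x∈p∩q⁺ (a∈T , ∈-tabulate⁺ (_≺? b) a≺b)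
    , λ a∈ → ≺-irrefl a (∈-tabulate⁻ (_≺? a) (proj₂ (x∈p∩q⁻ T _ a∈))))

  #below-invariant : ∀ {Φ T} (Φ∈G : G Φ) → image Φ T ≡ T → ∀ a → #below T a ≡ #below T (Φ a)
  #below-invariant Φ∈G ΦT≡T a = bijection⇒∣p∣≡∣q∣ (G-injective Φ∈G) (G-surjective Φ∈G)
    (λ z z∈ → let (z∈T , z≺a) = x∈p∩q⁻ _ _ z∈ in
      x∈p∩q⁺ (stable⁺ Φ∈G ΦT≡T z∈T , ∈-tabulate⁺ (_≺? _) (to (G-≺ Φ∈G) (∈-tabulate⁻ (_≺? a) z≺a))))
    (λ z Φz∈ → let (Φz∈T , Φz≺Φa) = x∈p∩q⁻ _ _ Φz∈ in
      x∈p∩q⁺ (stable⁻ Φ∈G ΦT≡T Φz∈T ,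
              ∈-tabulate⁺ (_≺? a) (from (G-≺ Φ∈G) (∈-tabulate⁻ (_≺? _) Φz≺Φa))))

  stabiliser-∼⇒fixed : ∀ {Φ T a} → G Φ → image Φ T ≡ T → a ∈ T → a ∼ Φ a → a ≡ Φ a
  stabiliser-∼⇒fixed Φ∈G ΦT≡T a∈T (inj₁ a≡Φa) = a≡Φa
  stabiliser-∼⇒fixed Φ∈G ΦT≡T a∈T (inj₂ (inj₁ a≺Φa)) =
    ⊥-elim (<-irrefl (#below-invariant Φ∈G ΦT≡T _) (#below-monotone a∈T a≺Φa))
  stabiliser-∼⇒fixed Φ∈G ΦT≡T a∈T (inj₂ (inj₂ Φa≺a)) =
    ⊥-elim (<-irrefl (sym (#below-invariant Φ∈G ΦT≡T _))
                     (#below-monotone (stable⁺ Φ∈G ΦT≡T a∈T) Φa≺a))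

  -- Weaving types of singletons

  made-⁅⁆⇒∼ : ∀ {X a y} → Made K X ⁅ a ⁆ → y ∈ X → a ∼ y
  made-⁅⁆⇒∼ {a = a} (inj₁ X≺a) y∈X = inj₂ (inj₂ (X≺a _ a y∈X (x∈⁅x⁆ a)))
  made-⁅⁆⇒∼ {a = a} (inj₂ a≺X) y∈X = inj₂ (inj₁ (a≺X _ a y∈X (x∈⁅x⁆ a)))

  incomparable-⁅⁆⇒≁ : ∀ {X a y} → Incomparable K X ⁅ a ⁆ → y ∈ X → ¬ a ∼ y
  incomparable-⁅⁆⇒≁ {a = a} X≁a y∈X a∼y = X≁a _ a y∈X (x∈⁅x⁆ a) (∼-sym a∼y)

  ≁⇒incomparable-⁅⁆ : ∀ {x a} → ¬ x ∼ a → Incomparable K ⁅ x ⁆ ⁅ a ⁆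
  ≁⇒incomparable-⁅⁆ {x} {a} x≁a x′ a′ x′∈ a′∈ =
    subst₂ (λ u v → ¬ u ∼ v) (sym (x∈⁅y⁆⇒x≡y x x′∈)) (sym (x∈⁅y⁆⇒x≡y a a′∈)) x≁a

  ∼⇒made-⁅⁆ : ∀ {x a} → x ≢ a → x ∼ a → Made K ⁅ x ⁆ ⁅ a ⁆
  ∼⇒made-⁅⁆ x≢a (inj₁ x≡a) = contradiction x≡a x≢a
  ∼⇒made-⁅⁆ {x} {a} _ (inj₂ (inj₁ x≺a)) = inj₁ λ x′ a′ x′∈ a′∈ →
    subst₂ _≺_ (sym (x∈⁅y⁆⇒x≡y x x′∈)) (sym (x∈⁅y⁆⇒x≡y a a′∈)) x≺a
  ∼⇒made-⁅⁆ {x} {a} _ (inj₂ (inj₂ a≺x)) = inj₂ λ x′ a′ x′∈ a′∈ →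
    subst₂ _≺_ (sym (x∈⁅y⁆⇒x≡y a a′∈)) (sym (x∈⁅y⁆⇒x≡y x x′∈)) a≺x

  woven-⁅⁆⇒∼ : ∀ {x a} → Woven K ⁅ x ⁆ ⁅ a ⁆ → x ∼ a
  woven-⁅⁆⇒∼ {x} {a} (_ , ¬incomparable) =
    decidable-stable (∼? x a) (¬incomparable ∘ ≁⇒incomparable-⁅⁆)

  sameWeavingType⇒#comparable≡ : ∀ {X a b} → SameWeavingType K X ⁅ a ⁆ X ⁅ b ⁆ →
                                 #comparable K a X ≡ #comparable K b X
  sameWeavingType⇒#comparable≡ (inj₁ (made₁ , made₂)) =
    trans (#comparable≡∣T∣ (λ _ → made-⁅⁆⇒∼ made₁)) (sym (#comparable≡∣T∣ (λ _ → made-⁅⁆⇒∼ made₂)))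
  sameWeavingType⇒#comparable≡ (inj₂ (inj₁ (inc₁ , inc₂))) =
    trans (#comparable≡0 (λ _ → incomparable-⁅⁆⇒≁ inc₁))
          (sym (#comparable≡0 (λ _ → incomparable-⁅⁆⇒≁ inc₂)))
  sameWeavingType⇒#comparable≡ {X} {a} (inj₂ (inj₂ (_ , _ , Φ , Φ∈G , ΦX≡X , Φa≡b))) =
    trans (#comparable-invariant Φ∈G ΦX≡X a)
          (cong (λ z → #comparable K z X) (⁅⁆-injective (trans (sym image-⁅⁆) Φa≡b)))

  sameWeavingType⇒∼⇔ : ∀ {x a b} → SameWeavingType K ⁅ x ⁆ ⁅ a ⁆ ⁅ x ⁆ ⁅ b ⁆ → x ∼ a ⇔ x ∼ b
  sameWeavingType⇒∼⇔ {x} (inj₁ (made₁ , made₂)) =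
    mk⇔ (const (∼-sym (made-⁅⁆⇒∼ made₂ (x∈⁅x⁆ x)))) (const (∼-sym (made-⁅⁆⇒∼ made₁ (x∈⁅x⁆ x))))
  sameWeavingType⇒∼⇔ {x} (inj₂ (inj₁ (inc₁ , inc₂))) =
    mk⇔ (⊥-elim ∘ incomparable-⁅⁆⇒≁ inc₁ (x∈⁅x⁆ x) ∘ ∼-sym)
        (⊥-elim ∘ incomparable-⁅⁆⇒≁ inc₂ (x∈⁅x⁆ x) ∘ ∼-sym)
  sameWeavingType⇒∼⇔ (inj₂ (inj₂ (woven₁ , woven₂ , _))) =
    mk⇔ (const (woven-⁅⁆⇒∼ woven₂)) (const (woven-⁅⁆⇒∼ woven₁))

  sameWeavingType-∈⇒stabiliser : ∀ {X x y} → x ∈ X → SameWeavingType K X ⁅ x ⁆ X ⁅ y ⁆ →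
                                 ∃ λ Φ → G Φ × image Φ X ≡ X × Φ x ≡ y
  sameWeavingType-∈⇒stabiliser {x = x} x∈X (inj₁ (inj₁ X≺x , _)) =
    contradiction (X≺x x x x∈X (x∈⁅x⁆ x)) (≺-irrefl x)
  sameWeavingType-∈⇒stabiliser {x = x} x∈X (inj₁ (inj₂ x≺X , _)) =
    contradiction (x≺X x x x∈X (x∈⁅x⁆ x)) (≺-irrefl x)
  sameWeavingType-∈⇒stabiliser x∈X (inj₂ (inj₁ (inc , _))) =
    contradiction (inj₁ refl) (incomparable-⁅⁆⇒≁ inc x∈X)
  sameWeavingType-∈⇒stabiliser x∈X (inj₂ (inj₂ (_ , _ , Φ , Φ∈G , ΦX≡X , Φx≡y))) =
    Φ , Φ∈G , ΦX≡X , ⁅⁆-injective (trans (sym image-⁅⁆) Φx≡y)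

  conj-⁅⁆ : ∀ {y₀ Y b} → InOrbit K y₀ b → b ∈ Y → Conj K ⁅ y₀ ⁆ Y ⁅ b ⁆
  conj-⁅⁆ {b = b} (Φ , Φ∈G , Φy₀≡b) b∈Y =
    (Φ , Φ∈G , trans (cong ⁅_⁆ (sym Φy₀≡b)) (sym image-⁅⁆)) ,
    λ z∈ → subst (_∈ _) (sym (x∈⁅y⁆⇒x≡y b z∈)) b∈Y

  conj-⁅⁆⁻ : ∀ {y₀ Y S₁} → Conj K ⁅ y₀ ⁆ Y S₁ → ∃ λ b → b ∈ Y × S₁ ≡ ⁅ b ⁆
  conj-⁅⁆⁻ {y₀} ((Φ , _ , S₁≡Φ⁅y₀⁆) , S₁⊆Y) =
    Φ y₀ , S₁⊆Y (subst (Φ y₀ ∈_) (sym S₁≡⁅Φy₀⁆) (x∈⁅x⁆ (Φ y₀))) , S₁≡⁅Φy₀⁆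
    where S₁≡⁅Φy₀⁆ = trans S₁≡Φ⁅y₀⁆ image-⁅⁆

  module _ {X Y y₀} (Y⊆orbit : ∀ b → b ∈ Y → InOrbit K y₀ b) (¬X▶Y : ¬ Triangle K X Y ⁅ y₀ ⁆) where

    ¬triangle⇒sameWeavingType : ∀ {a b} → a ∈ Y → b ∈ Y → ¬ ¬ SameWeavingType K X ⁅ a ⁆ X ⁅ b ⁆
    ¬triangle⇒sameWeavingType a∈Y b∈Y ¬same =
      ¬X▶Y (λ all → ¬same (all _ _ (conj-⁅⁆ (Y⊆orbit _ a∈Y) a∈Y) (conj-⁅⁆ (Y⊆orbit _ b∈Y) b∈Y)))

    ¬triangle⇒#comparable-constant : ∀ a b → a ∈ Y → b ∈ Y → #comparable K a X ≡ #comparable K b X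
    ¬triangle⇒#comparable-constant a b a∈Y b∈Y =
      decidable-stable (#comparable K a X ≟ℕ #comparable K b X)
        (λ ≢ → ¬triangle⇒sameWeavingType a∈Y b∈Y (≢ ∘ sameWeavingType⇒#comparable≡))

  module _ {x Y y₀} (x▶Y : Triangle K ⁅ x ⁆ Y ⁅ y₀ ⁆) where

    triangle-⁅⁆⇒0<#comparable : 0 < #comparable K x Y
    triangle-⁅⁆⇒0<#comparable = ≰⇒> λ #≤0 → x▶Y λ _ _ conj₁ conj₂ →
      inj₂ (inj₁ (incomparable #≤0 conj₁ , incomparable #≤0 conj₂))
      where
      incomparable : #comparable K x Y ≤ 0 → ∀ {S₁} → Conj K ⁅ y₀ ⁆ Y S₁ → Incomparable K ⁅ x ⁆ S₁
      incomparable #≤0 conj with conj-⁅⁆⁻ conj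
      ... | b , b∈Y , refl = ≁⇒incomparable-⁅⁆ (#comparable≤0⇒≁ #≤0 b∈Y)

    triangle-⁅⁆⇒#comparable<∣Y∣ : x ∉ Y → #comparable K x Y < ∣ Y ∣
    triangle-⁅⁆⇒#comparable<∣Y∣ x∉Y = ≰⇒> λ ∣Y∣≤# → x▶Y λ _ _ conj₁ conj₂ →
      inj₁ (made ∣Y∣≤# conj₁ , made ∣Y∣≤# conj₂)
      where
      made : ∣ Y ∣ ≤ #comparable K x Y → ∀ {S₁} → Conj K ⁅ y₀ ⁆ Y S₁ → Made K ⁅ x ⁆ S₁
      made ∣Y∣≤# conj with conj-⁅⁆⁻ conj
      ... | b , b∈Y , refl =
        ∼⇒made-⁅⁆ (λ x≡b → x∉Y (subst (_∈ Y) (sym x≡b) b∈Y)) (∣T∣≤#comparable⇒∼ ∣Y∣≤# b∈Y)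

  0<#comparable<∣Y∣⇒triangle-⁅⁆ : ∀ {x Y y₀} → (∀ b → b ∈ Y → InOrbit K y₀ b) → y₀ ∈ Y →
    0 < #comparable K x Y → #comparable K x Y < ∣ Y ∣ → Triangle K ⁅ x ⁆ Y ⁅ y₀ ⁆
  0<#comparable<∣Y∣⇒triangle-⁅⁆ {x} {Y} {y₀} Y⊆orbit y₀∈Y 0<# #<∣Y∣ all = by-cases (∼? x y₀)
    where
    ∼⇔ : ∀ {y} → y ∈ Y → x ∼ y₀ ⇔ x ∼ y
    ∼⇔ y∈Y = sameWeavingType⇒∼⇔
      (all _ _ (conj-⁅⁆ (Y⊆orbit _ y₀∈Y) y₀∈Y) (conj-⁅⁆ (Y⊆orbit _ y∈Y) y∈Y))
    by-cases : Dec (x ∼ y₀) → ⊥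
    by-cases (yes x∼y₀) = <-irrefl (#comparable≡∣T∣ λ y y∈Y → to (∼⇔ y∈Y) x∼y₀) #<∣Y∣
    by-cases (no  x≁y₀) = <-irrefl (sym (#comparable≡0 λ y y∈Y → x≁y₀ ∘ from (∼⇔ y∈Y))) 0<#

  -- The successor of a singleton

  record OrbitNeighbourhood (x : Fin n) (Y : Subset n) : Set where
    field
      centre∈    : x ∈ Y
      ⊆orbit     : ∀ y → y ∈ Y → InOrbit K x y
      nontrivial : ∃ λ y → y ∈ Y × y ≢ x

  module _ {x} {N : Nesting n} (N-primitive : IsPrimitiveNesting K x N) where
    open Nesting N

    private
      chain₀≡⁅base⁆ = proj₁ (proj₂ N-primitive)
      chain-len⇔orbit = proj₁ (proj₂ (proj₂ N-primitive))
      chain-block = proj₁ (proj₂ (proj₂ (proj₂ N-primitive)))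
      chain-⊂ = proj₁ (proj₂ (proj₂ (proj₂ (proj₂ N-primitive))))

    nontrivial-orbit⇒0<len : (∃ λ x′ → InOrbit K x x′ × x′ ≢ x) → 0 < len
    nontrivial-orbit⇒0<len (x′ , x→x′ , x′≢x) = n≢0⇒n>0 λ len≡0 →
      x′≢x (trans (≡base len≡0 x→x′) (sym (≡base len≡0 (id , G-id , refl))))
      where
      ≡base : len ≡ 0 → ∀ {y} → InOrbit K x y → y ≡ base
      ≡base len≡0 {y} x→y = x∈⁅y⁆⇒x≡y base (subst (y ∈_) chain₀≡⁅base⁆
        (subst (λ i → y ∈ chain i) len≡0 (from (chain-len⇔orbit y) x→y)))

    successor-orbitNeighbourhood : (∃ λ x′ → InOrbit K x x′ × x′ ≢ x) →
      ∀ {Φ} → G Φ → Φ base ≡ x → OrbitNeighbourhood x (image Φ (chain 1))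
    successor-orbitNeighbourhood nontrivial-orbit {Φ} Φ∈G Φbase≡x = record
      { centre∈    = subst (_∈ image Φ (chain 1)) Φbase≡x (∈-image⁺ base∈chain₁)
      ; ⊆orbit     = ⊆orbit
      ; nontrivial = other-element (proj₂ (chain-⊂ 0 0<len))
      }
      where
      0<len = nontrivial-orbit⇒0<len nontrivial-orbit
      base∈chain₀ = subst (base ∈_) (sym chain₀≡⁅base⁆) (x∈⁅x⁆ base)
      base∈chain₁ = proj₁ (chain-⊂ 0 0<len) base∈chain₀

      ⊆orbit : ∀ y → y ∈ image Φ (chain 1) → InOrbit K x y
      ⊆orbit y y∈ with ∈-image⁻ y∈
      ... | z , z∈chain₁ , Φz≡y with proj₁ (chain-block 1 0<len) z z∈chain₁
      ... | Ψ , Ψ∈G , Ψx≡z = Φ ∘ Ψ , G-∘ Φ∈G Ψ∈G , trans (cong Φ Ψx≡z) Φz≡y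

      other-element : (∃ λ z → z ∈ chain 1 × z ∉ chain 0) → ∃ λ y → y ∈ image Φ (chain 1) × y ≢ x
      other-element (z , z∈chain₁ , z∉chain₀) = Φ z , ∈-image⁺ z∈chain₁ , λ Φz≡x →
        z∉chain₀ (subst (_∈ chain 0) (sym (G-injective Φ∈G (trans Φz≡x (sym Φbase≡x)))) base∈chain₀)

  module Weaving {c s C S} (C† : OrbitNeighbourhood c C) (S† : OrbitNeighbourhood s S)
                 (¬C†▶S : ¬ Triangle K C S ⁅ s ⁆) (¬S†▶C : ¬ Triangle K S C ⁅ c ⁆) where
    open OrbitNeighbourhood

    #comparable-constantᶜ : ∀ a b → a ∈ C → b ∈ C → #comparable K a S ≡ #comparable K b S
    #comparable-constantᶜ = ¬triangle⇒#comparable-constant (⊆orbit C†) ¬S†▶C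

    #comparable-constantˢ : ∀ a b → a ∈ S → b ∈ S → #comparable K a C ≡ #comparable K b C
    #comparable-constantˢ = ¬triangle⇒#comparable-constant (⊆orbit S†) ¬C†▶S

    private
      k = #comparable K c S
      l = #comparable K s C

    ∣C∣*k≡∣S∣*l : ∣ C ∣ * k ≡ ∣ S ∣ * l
    ∣C∣*k≡∣S∣*l = #comparable-double-counting
      (λ a a∈C → #comparable-constantᶜ a c a∈C (centre∈ C†))
      (λ b b∈S → #comparable-constantˢ b s b∈S (centre∈ S†))

    c∈S⇒c≁some-of-S : c ∈ S → ¬ (∀ y → y ∈ S → c ∼ y)
    c∈S⇒c≁some-of-S c∈S c∼S =
      ¬triangle⇒sameWeavingType (⊆orbit S†) ¬C†▶S c∈S (C⊆S y∈C) λ same →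
        let (Φ , Φ∈G , ΦC≡C , Φc≡y) = sameWeavingType-∈⇒stabiliser (centre∈ C†) same
            c≡Φc = stabiliser-∼⇒fixed Φ∈G ΦC≡C (centre∈ C†)
                     (subst (c ∼_) (sym Φc≡y) (c∼S y (C⊆S y∈C)))
        in y≢c (sym (trans c≡Φc Φc≡y))
      where
      y = proj₁ (nontrivial C†)
      y∈C = proj₁ (proj₂ (nontrivial C†))
      y≢c = proj₂ (proj₂ (nontrivial C†))
      C⊆S : C ⊆ S
      C⊆S {b} b∈C = decidable-stable (b ∈? S) λ b∉S →
        ¬triangle⇒sameWeavingType (⊆orbit C†) ¬S†▶C (centre∈ C†) b∈C λ same →
        let (Φ , Φ∈G , ΦS≡S , Φc≡b) = sameWeavingType-∈⇒stabiliser c∈S same in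
        b∉S (subst (_∈ S) Φc≡b (stable⁺ Φ∈G ΦS≡S c∈S))

    module _ (c▶S : Triangle K ⁅ c ⁆ S ⁅ s ⁆) where

      0<k : 0 < k
      0<k = triangle-⁅⁆⇒0<#comparable c▶S

      k<∣S∣ : k < ∣ S ∣
      k<∣S∣ with c ∈? S
      ... | yes c∈S = ≰⇒> λ ∣S∣≤k → c∈S⇒c≁some-of-S c∈S λ _ → ∣T∣≤#comparable⇒∼ ∣S∣≤k
      ... | no  c∉S = triangle-⁅⁆⇒#comparable<∣Y∣ c▶S c∉S

      0<∣C∣ : 0 < ∣ C ∣
      0<∣C∣ = m<n⇒0<n (x∈p⇒∣p-x∣<∣p∣ (centre∈ C†))

      l<∣C∣ : l < ∣ C ∣
      l<∣C∣ = m*k≡s*l⇒l<m ∣ C ∣ {{>-nonZero 0<∣C∣}} k<∣S∣ ∣C∣*k≡∣S∣*l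

      0<l : 0 < l
      0<l = m*k≡s*l⇒0<l {s = ∣ S ∣} 0<∣C∣ 0<k ∣C∣*k≡∣S∣*l

      s▶C : Triangle K ⁅ s ⁆ C ⁅ c ⁆
      s▶C = 0<#comparable<∣Y∣⇒triangle-⁅⁆ (⊆orbit C†) (centre∈ C†) 0<l l<∣C∣

      #comparable<∣S∣ᶜ : ∀ a → a ∈ C → #comparable K a S < ∣ S ∣
      #comparable<∣S∣ᶜ a a∈C = subst (_< ∣ S ∣) (#comparable-constantᶜ c a (centre∈ C†) a∈C) k<∣S∣

      #comparable<∣C∣ˢ : ∀ b → b ∈ S → #comparable K b C < ∣ C ∣
      #comparable<∣C∣ˢ b b∈S = subst (_< ∣ C ∣) (#comparable-constantˢ s b (centre∈ S†) b∈S) l<∣C∣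

      prime⇒∣S∣∣∣C∣ : Prime ∣ S ∣ → ∣ S ∣ ∣ ∣ C ∣
      prime⇒∣S∣∣∣C∣ ∣S∣-prime =
        prime∣m*k⇒∣m ∣S∣-prime 0<k k<∣S∣ (divides l (trans ∣C∣*k≡∣S∣*l (*-comm ∣ S ∣ l)))

lemma5p16 : ∀ {n} (K : StdConfig n) (N : Fin n → Nesting n) →
  (∀ x → IsPrimitiveNesting K x (N x)) →
  (∀ x y → InOrbit K x y → N x ≡ N y) →
  ∀ (c s : Fin n) →
  (∃ λ c′ → InOrbit K c c′ × c′ ≢ c) →
  (∃ λ s′ → InOrbit K s s′ × s′ ≢ s) →
  ∀ (Φc Φs : Fin n → Fin n) →
  StdConfig.G K Φc → Φc (Nesting.base (N c)) ≡ c →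
  StdConfig.G K Φs → Φs (Nesting.base (N s)) ≡ s →
  let C† = image Φc (Nesting.chain (N c) 1)
      S† = image Φs (Nesting.chain (N s) 1)
  in ¬ Triangle K C† S† ⁅ s ⁆ →
     ¬ Triangle K S† C† ⁅ c ⁆ →
     ((∀ a b → a ∈ C† → b ∈ C† → #comparable K a S† ≡ #comparable K b S†) ×
      (∀ a b → a ∈ S† → b ∈ S† → #comparable K a C† ≡ #comparable K b C†)) ×
     (Triangle K ⁅ c ⁆ S† ⁅ s ⁆ →
        Triangle K ⁅ s ⁆ C† ⁅ c ⁆ ×
        (∀ a → a ∈ C† → #comparable K a S† < ∣ S† ∣) ×
        (∀ b → b ∈ S† → #comparable K b C† < ∣ C† ∣)) ×
     (Triangle K ⁅ c ⁆ S† ⁅ s ⁆ → Prime ∣ S† ∣ → ∣ S† ∣ ∣ ∣ C† ∣)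
lemma5p16 K N N-primitive _ c s c-nontrivial s-nontrivial Φc Φs Φc∈G Φc-base Φs∈G Φs-base
          ¬C†▶S ¬S†▶C =
  (#comparable-constantᶜ , #comparable-constantˢ) ,
  (λ c▶S → s▶C c▶S , #comparable<∣S∣ᶜ c▶S , #comparable<∣C∣ˢ c▶S) ,
  prime⇒∣S∣∣∣C∣
  where
  open Weaving K
    (successor-orbitNeighbourhood K (N-primitive c) c-nontrivial Φc∈G Φc-base)
    (successor-orbitNeighbourhood K (N-primitive s) s-nontrivial Φs∈G Φs-base)
    ¬C†▶S ¬S†▶C
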